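{- Let $1\le k\le n$, $\sigma\in\mathfrak{S}_n$, and $a_1,\dots,a_k,b_1,\dots,b_k\in\mathbb{F}_2$, and set $\Delta b_i:=b_{i+1}+b_i$ for $1\le i\le k-1$. A Boolean function $f(x_1,\dots,x_n)$ is $k$-canalizing with respect to $\sigma$, inputs $a_i$ and outputs $b_i$ if and only if there is a polynomial $\bar g=\bar g(x_{\sigma(k+1)},\dots,x_{\sigma(n)})\not\equiv 0$ such that, defining $h_k:=\bar g$ and $h_j:=(x_{\sigma(j+1)}+a_{j+1})h_{j+1}+\Delta b_j$ for $j=k-1,k-2,\dots,1$, we have $f=(x_{\sigma(1)}+a_1)\,h_1+b_1$; that is, $$f=(x_{\sigma(1)}+a_1)\Big[(x_{\sigma(2)}+a_2)\Big[\cdots\big[(x_{\sigma(k-1)}+a_{k-1})[(x_{\sigma(k)}+a_k)\bar g+\Delta b_{k-1}]+\Delta b_{k-2}\big]\cdots\Big]+\Delta b_1\Big]+b_1 .$$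
   Context: Boolean functions are identified with square-free polynomials in $\mathbb{F}_2[x_1,\dots,x_n]/\langle x_i^2-x_i\rangle$; $\overline{a}=a+1$. For $0\le k\le n$, $f$ is $k$-canalizing with respect to $\sigma\in\mathfrak{S}_n$, inputs $a_i$ and outputs $b_i$ ($1\le i\le k$) if: $f=b_1$ when $x_{\sigma(1)}=a_1$; $f=b_j$ when $x_{\sigma(i)}\ne a_i$ for all $i<j$ and $x_{\sigma(j)}=a_j$ ($2\le j\le k$); and $f=g$ when $x_{\sigma(i)}\neq a_i$ for all $i\le k$, where $g=g(x_{\sigma(k+1)},\dots,x_{\sigma(n)})$ is a Boolean function with $g\not\equiv b_k$. -}

module Defs where

open import Data.Nat using (ℕ; zero; suc; _≤_)
open import Data.Bool using (Bool; false; _xor_; _∧_)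
open import Data.Fin using (Fin; zero; suc; inject≤; _<_)
open import Data.Fin.Permutation using (Permutation′; _⟨$⟩ʳ_)
open import Data.Product using (Σ; _×_)
open import Relation.Binary.PropositionalEquality using (_≡_; _≢_)
open import Relation.Nullary using (¬_)

-- A Boolean function in n variables, identified (as in the paper) with its
-- square-free polynomial over F₂; polynomial equality = pointwise equality.
-- Addition in F₂ is xor, multiplication is ∧.
BoolFun : ℕ → Set
BoolFun n = (Fin n → Bool) → Bool

-- Throughout, k = suc m (so 1 ≤ k), indices are 0-based: paper's index i+1
-- corresponds to Fin index i.

pos : ∀ {m n} → suc m ≤ n → Permutation′ n → Fin (suc m) → Fin n
pos hkn σ i = σ ⟨$⟩ʳ inject≤ i hkn

DependsOnlyOnRest : ∀ {m n} → suc m ≤ n → Permutation′ n → BoolFun n → Set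
DependsOnlyOnRest {m} {n} hkn σ g =
  ∀ (x y : Fin n → Bool) →
  (∀ (j : Fin n) → (∀ (i : Fin (suc m)) → pos hkn σ i ≢ j) → x j ≡ y j) →
  g x ≡ g y

KCanalizing : ∀ (m n : ℕ) → suc m ≤ n → Permutation′ n →
              (a b : Fin (suc m) → Bool) → BoolFun n → Set
KCanalizing m n hkn σ a b f =
  (∀ (j : Fin (suc m)) (x : Fin n → Bool) →
     (∀ (i : Fin (suc m)) → i < j → x (pos hkn σ i) ≢ a i) →
     x (pos hkn σ j) ≡ a j → f x ≡ b j)
  × Σ (BoolFun n) (λ g →
        DependsOnlyOnRest hkn σ g
      × ¬ (∀ x → g x ≡ b (Data.Fin.fromℕ m))
      × (∀ (x : Fin n → Bool) →
           (∀ (i : Fin (suc m)) → x (pos hkn σ i) ≢ a i) → f x ≡ g x))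

-- h₁ for a given variable-position list p, inputs a, outputs b and ḡ:
-- hK := ḡ,  h_j := (x_{p(j+1)} + a_{j+1}) h_{j+1} + Δb_j, Δb_j = b_{j+1} + b_j.
hFirst : ∀ {n} (m : ℕ) → (Fin (suc m) → Fin n) → (a b : Fin (suc m) → Bool) →
         BoolFun n → BoolFun n
hFirst zero p a b g x = g x
hFirst (suc m) p a b g x =
  ((x (p (suc zero)) xor a (suc zero)) ∧
     hFirst m (λ i → p (suc i)) (λ i → a (suc i)) (λ i → b (suc i)) g x)
  xor (b (suc zero) xor b zero)

nestedForm : ∀ (m n : ℕ) → suc m ≤ n → Permutation′ n →
             (a b : Fin (suc m) → Bool) → BoolFun n → BoolFun n
nestedForm m n hkn σ a b g x =
  ((x (pos hkn σ zero) xor a zero) ∧ hFirst m (pos hkn σ) a b g x) xor b zero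

-- Unfolding the nested form along x: while x_{σ(i)} ≠ a_i the factor
-- (x_{σ(i)} + a_i) equals 1, so (x_{σ(i)} + a_i) h_i + b_i collapses to
-- (x_{σ(i+1)} + a_{i+1}) h_{i+1} + b_{i+1} (the Δb_i telescope); at the first
-- index j with x_{σ(j)} = a_j the factor vanishes and the value is b_j, and if
-- there is no such j the value is ḡ + b_k. Hence f is k-canalizing with
-- residual g exactly when f is the nested form for ḡ = g + b_k, and g ≢ b_k
-- becomes ḡ ≢ 0.
module Submission where

open import Defs
open import Data.Nat using (ℕ; zero; suc; _≤_; z≤n; s≤s)
open import Data.Bool using (Bool; false; true; _xor_; _∧_)
open import Data.Bool.Properties
  using (xor-assoc; xor-same; xor-identityʳ) renaming (_≟_ to _≟ᵇ_)
open import Data.Fin using (Fin; zero; suc; _<_; fromℕ)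
open import Data.Fin.Permutation using (Permutation′)
open import Data.Product using (Σ; ∃; _×_; _,_)
open import Data.Sum using (_⊎_; inj₁; inj₂)
open import Data.Empty using (⊥-elim)
open import Function using (_∘_)
open import Function.Bundles using (_⇔_; mk⇔)
open import Relation.Binary.PropositionalEquality
  using (_≡_; _≢_; refl; sym; trans; cong; module ≡-Reasoning)
open import Relation.Nullary using (¬_; yes; no)
open import Relation.Unary using (Pred; Decidable)

xor-cancelʳ : ∀ u v → (u xor v) xor v ≡ u
xor-cancelʳ u v = begin
  (u xor v) xor v  ≡⟨ xor-assoc u v v ⟩
  u xor (v xor v)  ≡⟨ cong (u xor_) (xor-same v) ⟩
  u xor false      ≡⟨ xor-identityʳ u ⟩
  u                ∎
  where open ≡-Reasoning

xor≡false⇒≡ : ∀ {u v} → u xor v ≡ false → u ≡ v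
xor≡false⇒≡ {u} {v} eq = trans (sym (xor-cancelʳ u v)) (cong (_xor v) eq)

≡⇒xor≡false : ∀ {u v} → u ≡ v → u xor v ≡ false
≡⇒xor≡false {u} refl = xor-same u

≢⇒xor≡true : ∀ {u v} → u ≢ v → u xor v ≡ true
≢⇒xor≡true {false} {false} u≢v = ⊥-elim (u≢v refl)
≢⇒xor≡true {false} {true}  _   = refl
≢⇒xor≡true {true}  {false} _   = refl
≢⇒xor≡true {true}  {true}  u≢v = ⊥-elim (u≢v refl)

least-or-none : ∀ {k p} {P : Pred (Fin k) p} → Decidable P →
                (∀ i → ¬ P i) ⊎ ∃ λ j → (∀ i → i < j → ¬ P i) × P j
least-or-none {zero}  P? = inj₁ λ ()
least-or-none {suc k} P? with P? zero | least-or-none (P? ∘ suc)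
... | yes P₀ | _                  = inj₂ (zero , (λ _ ()) , P₀)
... | no ¬P₀ | inj₁ none          = inj₁ λ { zero → ¬P₀ ; (suc i) → none i }
... | no ¬P₀ | inj₂ (j , ¬Pᵢ , Pⱼ) =
  inj₂ (suc j , (λ { zero _ → ¬P₀ ; (suc i) (s≤s i<j) → ¬Pᵢ i i<j }) , Pⱼ)

-- nestedForm m n hkn σ is definitionally nested m (pos hkn σ).
nested : ∀ {n} m → (Fin (suc m) → Fin n) → (a b : Fin (suc m) → Bool) →
         BoolFun n → BoolFun n
nested m p a b g x = ((x (p zero) xor a zero) ∧ hFirst m p a b g x) xor b zero

nested-skip : ∀ {n} m (p : Fin (suc (suc m)) → Fin n) a b g x →
              x (p zero) ≢ a zero →
              nested (suc m) p a b g x ≡ nested m (p ∘ suc) (a ∘ suc) (b ∘ suc) g x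
nested-skip m p a b g x mismatch = begin
  ((x (p zero) xor a zero) ∧ (t xor (b₁ xor b₀))) xor b₀
    ≡⟨ cong (λ c → (c ∧ (t xor (b₁ xor b₀))) xor b₀) (≢⇒xor≡true mismatch) ⟩
  (t xor (b₁ xor b₀)) xor b₀  ≡⟨ xor-assoc t (b₁ xor b₀) b₀ ⟩
  t xor ((b₁ xor b₀) xor b₀)  ≡⟨ cong (t xor_) (xor-cancelʳ b₁ b₀) ⟩
  t xor b₁                    ∎
  where
  open ≡-Reasoning
  b₀ = b zero
  b₁ = b (suc zero)
  t  = (x (p (suc zero)) xor a (suc zero)) ∧ hFirst m (p ∘ suc) (a ∘ suc) (b ∘ suc) g x

nested-at-first-match : ∀ {n} m (p : Fin (suc m) → Fin n) a b g x j →
                        (∀ i → i < j → x (p i) ≢ a i) → x (p j) ≡ a j →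
                        nested m p a b g x ≡ b j
nested-at-first-match m p a b g x zero _ match
  rewrite ≡⇒xor≡false match = refl
nested-at-first-match (suc m) p a b g x (suc j) earlier match = trans
  (nested-skip m p a b g x (earlier zero (s≤s z≤n)))
  (nested-at-first-match m (p ∘ suc) (a ∘ suc) (b ∘ suc) g x j
     (λ i i<j → earlier (suc i) (s≤s i<j)) match)

nested-without-match : ∀ {n} m (p : Fin (suc m) → Fin n) a b g x →
                       (∀ i → x (p i) ≢ a i) →
                       nested m p a b g x ≡ g x xor b (fromℕ m)
nested-without-match zero p a b g x none
  rewrite ≢⇒xor≡true (none zero) = refl
nested-without-match (suc m) p a b g x none = trans
  (nested-skip m p a b g x (none zero))
  (nested-without-match m (p ∘ suc) (a ∘ suc) (b ∘ suc) g x (none ∘ suc))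

theorem4p2 : ∀ (m n : ℕ) (hkn : suc m ≤ n) (σ : Permutation′ n)
               (a b : Fin (suc m) → Bool) (f : BoolFun n) →
               KCanalizing m n hkn σ a b f ⇔
               Σ (BoolFun n) (λ g →
                   DependsOnlyOnRest hkn σ g
                 × ¬ (∀ x → g x ≡ false)
                 × (∀ x → f x ≡ nestedForm m n hkn σ a b g x))
theorem4p2 m n hkn σ a b f = mk⇔ to from
  where
  p : Fin (suc m) → Fin n
  p = pos hkn σ

  bₖ : Bool
  bₖ = b (fromℕ m)

  NestedRepresentation : Set
  NestedRepresentation = Σ (BoolFun n) λ ḡ →
    DependsOnlyOnRest hkn σ ḡ × ¬ (∀ x → ḡ x ≡ false) ×
    (∀ x → f x ≡ nestedForm m n hkn σ a b ḡ x)

  shift-depends : ∀ {g} → DependsOnlyOnRest hkn σ g →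
                  DependsOnlyOnRest hkn σ (λ x → g x xor bₖ)
  shift-depends dep x y agree = cong (_xor bₖ) (dep x y agree)

  to : KCanalizing m n hkn σ a b f → NestedRepresentation
  to (canalizes , g , dep , g≢bₖ , residual) =
    (λ x → g x xor bₖ) , shift-depends dep ,
    (λ ḡ≡0 → g≢bₖ (xor≡false⇒≡ ∘ ḡ≡0)) , agrees
    where
    agrees : ∀ x → f x ≡ nested m p a b (λ y → g y xor bₖ) x
    agrees x with least-or-none (λ i → x (p i) ≟ᵇ a i)
    ... | inj₁ none = trans (residual x none) (sym (trans
          (nested-without-match m p a b _ x none) (xor-cancelʳ (g x) bₖ)))
    ... | inj₂ (j , earlier , match) = trans (canalizes j x earlier match)
          (sym (nested-at-first-match m p a b _ x j earlier match))

  from : NestedRepresentation → KCanalizing m n hkn σ a b f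
  from (ḡ , dep , ḡ≢0 , f≡nested) =
    (λ j x earlier match →
       trans (f≡nested x) (nested-at-first-match m p a b ḡ x j earlier match)) ,
    (λ x → ḡ x xor bₖ) , shift-depends dep ,
    (λ g≡bₖ → ḡ≢0 λ x → trans (sym (xor-cancelʳ (ḡ x) bₖ)) (≡⇒xor≡false (g≡bₖ x))) ,
    λ x none → trans (f≡nested x) (nested-without-match m p a b ḡ x none)
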